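{- Let $k>1$ be an integer and write $k-1=ab^2$ with $a,b$ positive integers and $a$ square-free. If $x,y,z$ are positive integers with $x^2+(2k-1)^y=k^z$, then $x\equiv 0\pmod{ab}$. -}

module Defs where

open import Data.Nat using (ℕ; _*_)
open import Data.Nat.Divisibility using (_∣_)
open import Relation.Binary.PropositionalEquality using (_≡_)

SquareFree : ℕ → Set
SquareFree a = ∀ (d : ℕ) → d * d ∣ a → d ≡ 1

-- Both 2k − 1 = 1 + 2(k − 1) and k are ≡ 1 modulo k − 1, hence so are all their powers, and
-- the equation reduces to x² ≡ 0 (mod k − 1 = ab²). Then b² ∣ x² gives b ∣ x, say x = bx′,
-- and cancelling b² leaves a ∣ x′², so a ∣ x′ because a is square-free; thus ab ∣ x.
module Submission where

open import Defs
open import Data.Nat using (ℕ; _+_; _*_; _∸_; _^_; _<_; NonZero; suc; >-nonZero; ≢-nonZero; ≢-nonZero⁻¹)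
open import Data.Nat.Divisibility
open import Data.Nat.Properties using (suc-injective; +-suc; +-comm; *-comm; *-identityʳ; m*n≢0)
open import Data.Nat.DivMod using (_/_; m*[n/m]≡n)
open import Data.Nat.GCD using (gcd; gcd[m,n]∣m; gcd[m,n]∣n; gcd[m,n]≢0)
open import Data.Nat.Coprimality using (Coprime; coprime-/gcd; coprime-divisor)
open import Data.Nat.Tactic.RingSolver using (solve-∀)
open import Data.Product using (∃-syntax; _×_; _,_)
open import Data.Sum using (inj₁)
open import Relation.Binary.PropositionalEquality using (_≡_; refl; sym; trans; cong; subst; subst₂)

infix 4 _≡1mod_

_≡1mod_ : ℕ → ℕ → Set
n ≡1mod d = ∃[ v ] d ∣ v × n ≡ 1 + v

^-≡1mod : ∀ {d n} → n ≡1mod d → ∀ e → n ^ e ≡1mod d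
^-≡1mod {d} n≡1 0 = 0 , d ∣0 , refl
^-≡1mod {n = n} n≡1@(u , d∣u , refl) (suc e) with ^-≡1mod n≡1 e
... | v , d∣v , nᵉ≡1+v = v + u * suc v , ∣m∣n⇒∣m+n d∣v (∣-trans d∣u (m∣m*n (suc v))) , cong (n *_) nᵉ≡1+v

square+≡1mod⇒∣square : ∀ {d} x {s t} → x * x + s ≡ t → s ≡1mod d → t ≡1mod d → d ∣ x * x
square+≡1mod⇒∣square x eq (v , d∣v , refl) (w , d∣w , refl) = ∣m+n∣m⇒∣n (subst (_ ∣_) w≡v+x*x d∣w) d∣v
  where
  w≡v+x*x : w ≡ v + x * x
  w≡v+x*x = trans (sym (suc-injective (trans (sym (+-suc (x * x) v)) eq))) (+-comm (x * x) v)

coprime-factorisation : ∀ m n .{{_ : NonZero m}} →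
  ∃[ g ] ∃[ m′ ] ∃[ n′ ] NonZero g × m ≡ g * m′ × n ≡ g * n′ × Coprime m′ n′
coprime-factorisation m n =
  gcd m n , m / gcd m n , n / gcd m n , gcd≢0
  , sym (m*[n/m]≡n (gcd[m,n]∣m m n)) , sym (m*[n/m]≡n (gcd[m,n]∣n m n)) , coprime-/gcd m n
  where
  instance
    gcd≢0 : NonZero (gcd m n)
    gcd≢0 = ≢-nonZero (gcd[m,n]≢0 m n (inj₁ (≢-nonZero⁻¹ m)))

m*m∣n*n⇒m∣n : ∀ m n .{{_ : NonZero m}} → m * m ∣ n * n → m ∣ n
m*m∣n*n⇒m∣n m n m²∣n² with coprime-factorisation m n
... | g , m′ , n′ , g≢0 , refl , refl , m′⊥n′ = *-monoʳ-∣ g m′∣n′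
  where
  instance
    _ = g≢0
    g²≢0 : NonZero (g * g)
    g²≢0 = m*n≢0 g g
  square-* : ∀ g m → (g * m) * (g * m) ≡ (g * g) * (m * m)
  square-* = solve-∀
  m′²∣n′² : m′ * m′ ∣ n′ * n′
  m′²∣n′² = *-cancelˡ-∣ (g * g) (subst₂ _∣_ (square-* g m′) (square-* g n′) m²∣n²)
  m′∣n′ : m′ ∣ n′
  m′∣n′ = coprime-divisor m′⊥n′ (∣-trans (m∣m*n m′) m′²∣n′²)

-- Writing a = g a′, n = g n′ with g = gcd a n, coprimality forces a′ ∣ g, so a′² ∣ a.
squareFree∧∣n*n⇒∣n : ∀ {a} n .{{_ : NonZero a}} → SquareFree a → a ∣ n * n → a ∣ n
squareFree∧∣n*n⇒∣n n sf a∣n² with coprime-factorisation _ n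
... | g , a′ , n′ , g≢0 , refl , refl , a′⊥n′ = *-monoʳ-∣ g (subst (_∣ n′) (sym a′≡1) (1∣ n′))
  where
  instance _ = g≢0
  square-* : ∀ g n → (g * n) * (g * n) ≡ g * (n * (n * g))
  square-* = solve-∀
  a′∣n′n′g : a′ ∣ n′ * (n′ * g)
  a′∣n′n′g = *-cancelˡ-∣ g (subst (g * a′ ∣_) (square-* g n′) a∣n²)
  a′∣g : a′ ∣ g
  a′∣g = coprime-divisor a′⊥n′ (coprime-divisor a′⊥n′ a′∣n′n′g)
  a′≡1 : a′ ≡ 1
  a′≡1 = sf a′ (subst (a′ * a′ ∣_) (*-comm a′ g) (*-monoʳ-∣ a′ a′∣g))

squareFree*square∣square⇒∣ : ∀ a b n .{{_ : NonZero a}} .{{_ : NonZero b}} → SquareFree a →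
  a * (b * b) ∣ n * n → a * b ∣ n
squareFree*square∣square⇒∣ a b n sf ab²∣n² = subst (a * b ∣_) (sym n≡n′b) (*-monoˡ-∣ b a∣n′)
  where
  instance
    b²≢0 : NonZero (b * b)
    b²≢0 = m*n≢0 b b
  b∣n : b ∣ n
  b∣n = m*m∣n*n⇒m∣n b n (m*n∣⇒n∣ a (b * b) ab²∣n²)
  n′ : ℕ
  n′ = quotient b∣n
  n≡n′b : n ≡ n′ * b
  n≡n′b = m∣n⇒n≡quotient*m b∣n
  square-* : ∀ n b → (n * b) * (n * b) ≡ (b * b) * (n * n)
  square-* = solve-∀
  b²a∣b²n′² : (b * b) * a ∣ (b * b) * (n′ * n′)
  b²a∣b²n′² = subst₂ _∣_ (*-comm a (b * b)) (square-* n′ b) (subst (λ t → a * (b * b) ∣ t * t) n≡n′b ab²∣n²)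
  a∣n′ : a ∣ n′
  a∣n′ = squareFree∧∣n*n⇒∣n n′ sf (*-cancelˡ-∣ (b * b) b²a∣b²n′²)

lemma4p1 : ∀ (k a b x y z : ℕ) → 1 < k → 0 < a → 0 < b → SquareFree a
             → k ∸ 1 ≡ a * (b * b)
             → 0 < x → 0 < y → 0 < z
             → x ^ 2 + (2 * k ∸ 1) ^ y ≡ k ^ z
             → a * b ∣ x
lemma4p1 (suc m) a b x y z _ 0<a 0<b sf m≡ab² _ _ _ eq =
  squareFree*square∣square⇒∣ a b x sf (subst (_∣ x * x) m≡ab² m∣x²)
  where
  instance
    _ = >-nonZero 0<a
    _ = >-nonZero 0<b
  2k∸1≡1 : 2 * suc m ∸ 1 ≡1mod m
  2k∸1≡1 = 2 * m , n∣m*n 2 , +-suc m (m + 0)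
  k≡1 : suc m ≡1mod m
  k≡1 = m , ∣-refl , refl
  x²+[2k∸1]ʸ≡kᶻ : x * x + (2 * suc m ∸ 1) ^ y ≡ suc m ^ z
  x²+[2k∸1]ʸ≡kᶻ = subst (λ t → t + (2 * suc m ∸ 1) ^ y ≡ suc m ^ z) (cong (x *_) (*-identityʳ x)) eq
  m∣x² : m ∣ x * x
  m∣x² = square+≡1mod⇒∣square x x²+[2k∸1]ʸ≡kᶻ (^-≡1mod 2k∸1≡1 y) (^-≡1mod k≡1 z)
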